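{- Let $G$ be a finite simple graph, and let $(H,H')$, $M$ be chosen as in the standing setting below. Then $C(M,H)=P_e(M,H)=P_o^H(M,H)=\emptyset$.
   Context: $\nu(G)$ is the maximum matching size. $B_2(G)$ is the set of pairs $(H,H')$ of edge-disjoint matchings; $\lambda_2(G)=\max\{|H|+|H'|:(H,H')\in B_2(G)\}$; $\alpha_2(G)=\max\{|H|,|H'|:(H,H')\in B_2(G),\ |H|+|H'|=\lambda_2(G)\}$; $M_2(G)=\{(H,H')\in B_2(G): |H|+|H'|=\lambda_2(G),\ |H|=\alpha_2(G)\}$. For matchings $A,B$: a path or even cycle $e_1,\dots,e_l$ ($l\ge1$) is $A$-$B$ alternating if the edges with odd indices lie in $A\setminus B$ and the others in $B\setminus A$, or vice versa; an $A$-$B$ alternating path is maximal if it is not a proper subpath of another $A$-$B$ alternating path. $C(A,B)$ is the set of $A$-$B$ alternating cycles, $P(A,B)$ the set of maximal $A$-$B$ alternating paths, $P_e(A,B)$ and $P_o(A,B)$ those of even and odd length, and $P_o^A(A,B)$ (resp. $P_o^B(A,B)$) the paths in $P_o(A,B)$ whose first edge is in $A$ (resp. $B$). Standing setting: over all $(H,H')\in M_2(G)$ and all maximum matchings $M$ of $G$, consider the triples maximizing $|M\cap H|$; among these, $((H,H'),M)$ is chosen to maximize $|M\cap H'|$. -}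

module Defs where

open import Data.Nat using (ℕ; zero; suc; _+_; _≤_; _∸_)
open import Data.Nat.Divisibility using (_∣_)
open import Data.Bool using (Bool; true; false; _∧_; if_then_else_)
open import Data.Fin using (Fin; toℕ)
open import Data.Nat using (_<ᵇ_)
open import Data.List using (List; []; _∷_; _++_; length; map; allFin; [_])
open import Data.Nat.ListAction using (sum)
open import Data.List.Relation.Unary.Unique.Propositional using (Unique)
open import Data.Product using (_×_; Σ)
open import Data.Sum using (_⊎_)
open import Data.Unit using (⊤)
open import Data.Empty using (⊥)
open import Relation.Nullary using (¬_)
open import Relation.Binary.PropositionalEquality using (_≡_)

record Graph (n : ℕ) : Set where
  field
    adj   : Fin n → Fin n → Bool
    sym   : ∀ i j → adj i j ≡ adj j i
    irrefl : ∀ i → adj i i ≡ false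
open Graph public

-- A set of edges, given as a (symmetric) Boolean relation on vertices.
EdgeSet : ℕ → Set
EdgeSet n = Fin n → Fin n → Bool

_∩_ : ∀ {n} → EdgeSet n → EdgeSet n → EdgeSet n
(A ∩ B) i j = A i j ∧ B i j

size : ∀ {n} → EdgeSet n → ℕ
size {n} A = sum (map (λ i → sum (map (λ j → if (toℕ i <ᵇ toℕ j) ∧ A i j then 1 else 0) (allFin n))) (allFin n))

record IsMatching {n} (G : Graph n) (H : EdgeSet n) : Set where
  field
    symm   : ∀ i j → H i j ≡ H j i
    sub    : ∀ i j → H i j ≡ true → adj G i j ≡ true
    unique : ∀ i j k → H i j ≡ true → H i k ≡ true → j ≡ k

IsMaximumMatching : ∀ {n} → Graph n → EdgeSet n → Set
IsMaximumMatching G M = IsMatching G M × (∀ N → IsMatching G N → size N ≤ size M)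

InB2 : ∀ {n} → Graph n → EdgeSet n → EdgeSet n → Set
InB2 G H H' = IsMatching G H × IsMatching G H' × (∀ i j → H i j ≡ true → H' i j ≡ false)

-- (H , H') ∈ M₂(G): |H|+|H'| = λ₂(G) and |H| = α₂(G), with λ₂, α₂ unfolded
InM2 : ∀ {n} → Graph n → EdgeSet n → EdgeSet n → Set
InM2 G H H' =
  InB2 G H H'
  × (∀ K K' → InB2 G K K' → size K + size K' ≤ size H + size H')
  × (∀ K K' → InB2 G K K' → size K + size K' ≡ size H + size H' →
       size K ≤ size H × size K' ≤ size H)

-- Standing setting: ((H , H') , M) maximizes |M ∩ H| over all (H,H') ∈ M₂(G)
-- and maximum matchings M, and among those maximizes |M ∩ H'|.
StandingSetting : ∀ {n} → Graph n → EdgeSet n → EdgeSet n → EdgeSet n → Set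
StandingSetting G H H' M =
  InM2 G H H' × IsMaximumMatching G M
  × (∀ K K' N → InM2 G K K' → IsMaximumMatching G N → size (N ∩ K) ≤ size (M ∩ H))
  × (∀ K K' N → InM2 G K K' → IsMaximumMatching G N →
       size (N ∩ K) ≡ size (M ∩ H) → size (N ∩ K') ≤ size (M ∩ H'))

AltFrom : ∀ {n} → EdgeSet n → EdgeSet n → List (Fin n) → Set
AltFrom A B [] = ⊤
AltFrom A B (v ∷ []) = ⊤
AltFrom A B (u ∷ v ∷ vs) = A u v ≡ true × B u v ≡ false × AltFrom B A (v ∷ vs)

edges : ∀ {n} → List (Fin n) → ℕ
edges vs = length vs ∸ 1

AltPath : ∀ {n} → EdgeSet n → EdgeSet n → List (Fin n) → Set
AltPath A B vs = Unique vs × 1 ≤ edges vs × (AltFrom A B vs ⊎ AltFrom B A vs)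

MaxAltPath : ∀ {n} → EdgeSet n → EdgeSet n → List (Fin n) → Set
MaxAltPath A B vs =
  AltPath A B vs ×
  (∀ xs ys → AltPath A B (xs ++ vs ++ ys) → xs ≡ [] × ys ≡ [])

AltCycle : ∀ {n} → EdgeSet n → EdgeSet n → List (Fin n) → Set
AltCycle A B [] = ⊥
AltCycle A B (v ∷ vs) =
  Unique (v ∷ vs) × 3 ≤ length (v ∷ vs) × 2 ∣ length (v ∷ vs)
  × (AltFrom A B (v ∷ vs ++ [ v ]) ⊎ AltFrom B A (v ∷ vs ++ [ v ]))

module Submission where

-- If P is the edge set of an M-H alternating cycle or of a maximal M-H alternating path, let M' be
-- M with its edges in P replaced by the H-edges of P.  M' is a matching as soon as every M-edge at a
-- vertex of an H-edge of P lies in P itself.  For cycles this is automatic; for maximal paths an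
-- M-edge leaving P would either extend P (contradicting maximality) or join its two ends, closing an
-- alternating cycle.  In each of the three forbidden cases P has at least as many H-edges as M-edges
-- and at least one H-edge, so M' is again a maximum matching and shares strictly more edges with H
-- than M does, contradicting the choice of M.  Edges are counted through degree sums, vertex by
-- vertex, via the handshake lemma.

open import Defs hiding (sym)
open import Data.Bool using (Bool; true; false; _∧_; if_then_else_; T)
open import Data.Bool.Properties using (∧-zeroʳ)
open import Data.Empty using (⊥; ⊥-elim)
open import Data.Fin using (Fin; toℕ) renaming (zero to 0F; suc to 1+)
open import Data.Fin.Properties using (_≟_; toℕ-injective) renaming (suc-injective to 1+-injective)
open import Data.List using (List; []; _∷_; _++_; [_]; length; map; allFin; tabulate; head; last)
open import Data.List.Membership.Propositional using (_∈_; _∉_)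
open import Data.List.Properties using (map-tabulate; length-++; ++-identityʳ)
open import Data.List.Relation.Unary.All using ([]; _∷_)
open import Data.List.Relation.Unary.All.Properties using (¬Any⇒All¬; All¬⇒¬Any)
open import Data.List.Relation.Unary.AllPairs using ([]; _∷_)
open import Data.List.Relation.Unary.Any using (here; there; any?)
open import Data.List.Relation.Unary.Unique.Propositional using (Unique)
open import Data.List.Relation.Unary.Unique.Propositional.Properties using (++⁺)
open import Data.Maybe using (just)
open import Data.Maybe.Properties using (just-injective)
open import Data.Nat using (ℕ; zero; suc; _+_; _*_; _≤_; _<_; z≤n; s≤s; _<ᵇ_; _≤?_)
import Data.Nat.ListAction as ListAction
open import Data.Nat.Divisibility using (_∣_; divides)
open import Data.Nat.Properties
  using ( +-0-commutativeMonoid; +-comm; +-identityʳ; +-mono-≤; +-monoˡ-≤; +-monoʳ-≤; +-monoʳ-<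
        ; +-cancelʳ-≤; *-cancelˡ-≤; *-cancelˡ-<; m≤m+n; m≤n+m; ≤-trans; ≤-reflexive
        ; <⇒≱; ≰⇒>; n<1⇒n≡0; <-asym; <-cmp; <ᵇ⇒<; <⇒<ᵇ; module ≤-Reasoning)
open import Algebra.Properties.CommutativeMonoid.Sum +-0-commutativeMonoid
  using (sum-syntax; sum-cong-≗; ∑-distrib-+; ∑-comm; sum-replicate-zero)
open import Data.Product using (_×_; ∃-syntax; _,_; proj₁; proj₂)
open import Data.Sum using (_⊎_; inj₁; inj₂; [_,_]′; swap)
open import Data.Unit using (⊤; tt)
open import Function using (_∘_; id)
open import Function.Bundles using (mk⇔)
open import Relation.Binary.Definitions using (tri<; tri≈; tri>)
open import Relation.Binary.PropositionalEquality
  using (_≡_; _≢_; refl; sym; trans; cong; cong₂; subst; subst₂; module ≡-Reasoning)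
open import Relation.Nullary
  using (¬_; Dec; yes; no; does; _×-dec_; _⊎-dec_; decidable-stable; toSum)
open import Relation.Nullary.Decidable using (dec-true; does-⇔)

χ : Bool → ℕ
χ b = if b then 1 else 0

∧-true : ∀ {a b} → a ∧ b ≡ true → a ≡ true × b ≡ true
∧-true {true} b≡true = refl , b≡true

∧-intro : ∀ {a b} → a ≡ true → b ≡ true → a ∧ b ≡ true
∧-intro refl refl = refl

Even Odd : ℕ → Set
Even zero    = ⊤
Even (suc n) = Odd n
Odd zero     = ⊥
Odd (suc n)  = Even n

even⊎odd : ∀ n → Even n ⊎ Odd n
even⊎odd zero = inj₁ tt
even⊎odd (suc n) with even⊎odd n
... | inj₁ e = inj₂ e
... | inj₂ o = inj₁ o

even⇒¬odd : ∀ n → Even n → ¬ Odd n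
even⇒¬odd zero    _ ()
even⇒¬odd (suc n) o e = even⇒¬odd n e o

even⇒2∣ : ∀ n → Even n → 2 ∣ n
even⇒2∣ zero          _ = divides 0 refl
even⇒2∣ (suc (suc n)) e with even⇒2∣ n e
... | divides q n≡q*2 = divides (suc q) (cong (suc ∘ suc) n≡q*2)

2∣⇒even : ∀ n → 2 ∣ n → Even n
2∣⇒even n (divides q refl) = even-*2 q
  where
  even-*2 : ∀ q → Even (q * 2)
  even-*2 zero    = tt
  even-*2 (suc q) = even-*2 q

∑-mono-≤ : ∀ {n} {f g : Fin n → ℕ} → (∀ i → f i ≤ g i) →
           ∑[ i < n ] f i ≤ ∑[ i < n ] g i
∑-mono-≤ {zero}  f≤g = z≤n
∑-mono-≤ {suc n} f≤g = +-mono-≤ (f≤g 0F) (∑-mono-≤ (f≤g ∘ 1+))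

term≤∑ : ∀ {n} (f : Fin n → ℕ) k → f k ≤ ∑[ i < n ] f i
term≤∑ f 0F     = m≤m+n _ _
term≤∑ f (1+ k) = ≤-trans (term≤∑ (f ∘ 1+) k) (m≤n+m _ _)

∑-zero : ∀ {n} {f : Fin n → ℕ} → (∀ i → f i ≡ 0) → ∑[ i < n ] f i ≡ 0
∑-zero {n} f≡0 = trans (sum-cong-≗ f≡0) (sum-replicate-zero n)

δ : ∀ {n} → Fin n → Fin n → ℕ
δ t i = χ (does (i ≟ t))

∑-δ : ∀ {n} (t : Fin n) → ∑[ i < n ] δ t i ≡ 1
∑-δ {suc n} 0F     = cong suc (∑-zero {n} λ _ → refl)
∑-δ {suc n} (1+ t) = ∑-δ {n} t

∑-≤-exchange : ∀ {n} {f g : Fin n → ℕ} (h t : Fin n) →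
  (∀ i → f i + δ t i ≤ g i + δ h i) → ∑[ i < n ] f i ≤ ∑[ i < n ] g i
∑-≤-exchange {n} {f} {g} h t f+δt≤g+δh = +-cancelʳ-≤ 1 _ _ (begin
  ∑[ i < n ] f i + 1                     ≡⟨ cong (∑[ i < n ] f i +_) (∑-δ t) ⟨
  ∑[ i < n ] f i + ∑[ i < n ] δ t i      ≡⟨ ∑-distrib-+ f (δ t) ⟨
  ∑[ i < n ] (f i + δ t i)               ≤⟨ ∑-mono-≤ f+δt≤g+δh ⟩
  ∑[ i < n ] (g i + δ h i)               ≡⟨ ∑-distrib-+ g (δ h) ⟩
  ∑[ i < n ] g i + ∑[ i < n ] δ h i      ≡⟨ cong (∑[ i < n ] g i +_) (∑-δ h) ⟩
  ∑[ i < n ] g i + 1                     ∎)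
  where open ≤-Reasoning

∑χ≤1 : ∀ {n} (b : Fin n → Bool) → (∀ j k → b j ≡ true → b k ≡ true → j ≡ k) →
       ∑[ j < n ] χ (b j) ≤ 1
∑χ≤1 {zero}  b unique = z≤n
∑χ≤1 {suc n} b unique with b 0F in b₀
... | true  = ≤-reflexive (cong suc (∑-zero rest-false))
  where
  rest-false : ∀ j → χ (b (1+ j)) ≡ 0
  rest-false j with b (1+ j) in bⱼ
  ... | true  with () ← unique 0F (1+ j) b₀ bⱼ
  ... | false = refl
... | false = ∑χ≤1 (b ∘ 1+) (λ j k bj bk → 1+-injective (unique (1+ j) (1+ k) bj bk))

∑χ>0⇒∃ : ∀ {n} (b : Fin n → Bool) → 1 ≤ ∑[ j < n ] χ (b j) → ∃[ j ] b j ≡ true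
∑χ>0⇒∃ {suc n} b 1≤∑ with b 0F in b₀
... | true  = 0F , b₀
... | false with ∑χ>0⇒∃ (b ∘ 1+) 1≤∑
...   | j , bj = 1+ j , bj

∃⇒∑χ>0 : ∀ {n} (b : Fin n → Bool) k → b k ≡ true → 1 ≤ ∑[ j < n ] χ (b j)
∃⇒∑χ>0 b k bk = subst (_≤ _) (cong χ bk) (term≤∑ (χ ∘ b) k)

-- Edge sets, degrees and the handshake lemma

SymmetricEdges : ∀ {n} → EdgeSet n → Set
SymmetricEdges A = ∀ i j → A i j ≡ A j i

Loopless : ∀ {n} → EdgeSet n → Set
Loopless A = ∀ i → A i i ≡ false

record SimpleEdgeSet {n} (A : EdgeSet n) : Set where
  field
    symmetric : SymmetricEdges A
    loopless  : Loopless A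

AtMostOneNeighbour : ∀ {n} → EdgeSet n → Set
AtMostOneNeighbour A = ∀ i j k → A i j ≡ true → A i k ≡ true → j ≡ k

Covers : ∀ {n} → EdgeSet n → Fin n → Set
Covers A i = ∃[ j ] A i j ≡ true

degree : ∀ {n} → EdgeSet n → Fin n → ℕ
degree {n} A i = ∑[ j < n ] χ (A i j)

degreeSum : ∀ {n} → EdgeSet n → ℕ
degreeSum {n} A = ∑[ i < n ] degree A i

module _ {n} {A : EdgeSet n} where

  degree≤1 : AtMostOneNeighbour A → ∀ i → degree A i ≤ 1
  degree≤1 unique i = ∑χ≤1 (A i) (unique i)

  covers⇒degree>0 : ∀ {i} → Covers A i → 1 ≤ degree A i
  covers⇒degree>0 {i} (j , Aij) = ∃⇒∑χ>0 (A i) j Aij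

  degree>0⇒covers : ∀ {i} → 1 ≤ degree A i → Covers A i
  degree>0⇒covers {i} = ∑χ>0⇒∃ (A i)

  ¬covers⇒degree≡0 : ∀ {i} → ¬ Covers A i → degree A i ≡ 0
  ¬covers⇒degree≡0 {i} uncovered = ∑-zero not-adjacent
    where
    not-adjacent : ∀ j → χ (A i j) ≡ 0
    not-adjacent j with A i j in Aij
    ... | true  = ⊥-elim (uncovered (j , Aij))
    ... | false = refl

module _ {n} {A B : EdgeSet n} where

  degree-mono : AtMostOneNeighbour A → ∀ {i} → (Covers A i → Covers B i) → degree A i ≤ degree B i
  degree-mono unique {i} A⇒B with 1 ≤? degree A i
  ... | yes 1≤dA =
    ≤-trans (degree≤1 unique i) (covers⇒degree>0 {A = B} (A⇒B (degree>0⇒covers {A = A} 1≤dA)))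
  ... | no  1≰dA = ≤-trans (≤-reflexive (n<1⇒n≡0 (≰⇒> 1≰dA))) z≤n

  degreeSum-mono : AtMostOneNeighbour A → (∀ i → Covers A i → Covers B i) →
                   degreeSum A ≤ degreeSum B
  degreeSum-mono unique A⇒B = ∑-mono-≤ (λ i → degree-mono unique (A⇒B i))

  degreeSum-exchange : AtMostOneNeighbour A → ∀ {h t} → h ≢ t →
    (∀ i → i ≢ h → Covers A i → Covers B i) → ¬ Covers A t → Covers B t →
    degreeSum A ≤ degreeSum B
  degreeSum-exchange unique {h} {t} h≢t A⇒B uncovered covered = ∑-≤-exchange h t pointwise
    where
    pointwise : ∀ i → degree A i + δ t i ≤ degree B i + δ h i
    pointwise i with i ≟ h | i ≟ t
    ... | yes refl | yes refl = ⊥-elim (h≢t refl)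
    ... | yes refl | no _     =
          ≤-trans (≤-reflexive (+-identityʳ _)) (≤-trans (degree≤1 unique i) (m≤n+m 1 _))
    ... | no _     | yes refl =
          ≤-trans (≤-reflexive (cong (_+ 1) (¬covers⇒degree≡0 {A = A} uncovered)))
                  (≤-trans (covers⇒degree>0 {A = B} covered) (≤-reflexive (sym (+-identityʳ _))))
    ... | no i≢h   | no _     = +-monoˡ-≤ 0 (degree-mono unique (A⇒B i i≢h))

upper : ∀ {n} → EdgeSet n → Fin n → Fin n → ℕ
upper A i j = χ ((toℕ i <ᵇ toℕ j) ∧ A i j)

listSum-allFin : ∀ {n} (f : Fin n → ℕ) → ListAction.sum (map f (allFin n)) ≡ ∑[ i < n ] f i
listSum-allFin f = trans (cong ListAction.sum (map-tabulate id f)) (listSum-tabulate f)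
  where
  listSum-tabulate : ∀ {n} (f : Fin n → ℕ) → ListAction.sum (tabulate f) ≡ ∑[ i < n ] f i
  listSum-tabulate {zero}  f = refl
  listSum-tabulate {suc n} f = cong (f 0F +_) (listSum-tabulate (f ∘ 1+))

size≡∑∑upper : ∀ {n} (A : EdgeSet n) → size A ≡ ∑[ i < n ] ∑[ j < n ] upper A i j
size≡∑∑upper {n} A = trans (listSum-allFin (λ i → ListAction.sum (map (upper A i) (allFin n))))
                            (sum-cong-≗ (λ i → listSum-allFin (upper A i)))

χ≡upper+upper : ∀ {n} {A : EdgeSet n} → SimpleEdgeSet A →
                ∀ i j → χ (A i j) ≡ upper A i j + upper A j i
χ≡upper+upper {A = A} simple i j
  with toℕ i <ᵇ toℕ j in i<ᵇj | toℕ j <ᵇ toℕ i in j<ᵇi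
... | true  | true  = ⊥-elim (<-asym (<ᵇ⇒< (toℕ i) (toℕ j) (subst T (sym i<ᵇj) tt))
                                    (<ᵇ⇒< (toℕ j) (toℕ i) (subst T (sym j<ᵇi) tt)))
... | true  | false = sym (+-identityʳ _)
... | false | true  = cong χ (SimpleEdgeSet.symmetric simple i j)
... | false | false with <-cmp (toℕ i) (toℕ j)
...   | tri< i<j _ _ = ⊥-elim (subst T i<ᵇj (<⇒<ᵇ i<j))
...   | tri> _ _ j<i = ⊥-elim (subst T j<ᵇi (<⇒<ᵇ j<i))
...   | tri≈ _ i≡j _ rewrite toℕ-injective i≡j | SimpleEdgeSet.loopless simple j = refl

handshake : ∀ {n} {A : EdgeSet n} → SimpleEdgeSet A → degreeSum A ≡ 2 * size A
handshake {n} {A} simple = begin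
  degreeSum A
    ≡⟨ sum-cong-≗ (λ i → sum-cong-≗ (χ≡upper+upper simple i)) ⟩
  ∑[ i < n ] ∑[ j < n ] (upper A i j + upper A j i)
    ≡⟨ sum-cong-≗ (λ i → ∑-distrib-+ (upper A i) (λ j → upper A j i)) ⟩
  ∑[ i < n ] (∑[ j < n ] upper A i j + ∑[ j < n ] upper A j i)
    ≡⟨ ∑-distrib-+ (λ i → ∑[ j < n ] upper A i j) (λ i → ∑[ j < n ] upper A j i) ⟩
  ∑[ i < n ] ∑[ j < n ] upper A i j + ∑[ i < n ] ∑[ j < n ] upper A j i
    ≡⟨ cong (∑[ i < n ] ∑[ j < n ] upper A i j +_) (∑-comm (λ i j → upper A j i)) ⟩
  ∑[ i < n ] ∑[ j < n ] upper A i j + ∑[ j < n ] ∑[ i < n ] upper A j i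
    ≡⟨ cong₂ _+_ (size≡∑∑upper A) (size≡∑∑upper A) ⟨
  size A + size A
    ≡⟨ cong (size A +_) (+-identityʳ (size A)) ⟨
  2 * size A
    ∎
  where open ≡-Reasoning

size-additive : ∀ {n} {A B C D : EdgeSet n} →
  (∀ i j → χ (A i j) + χ (B i j) ≡ χ (C i j) + χ (D i j)) →
  size A + size B ≡ size C + size D
size-additive {n} {A} {B} {C} {D} pointwise = begin
  size A + size B                    ≡⟨ cong₂ _+_ (size≡∑∑upper A) (size≡∑∑upper B) ⟩
  ∑∑ (upper A) + ∑∑ (upper B)        ≡⟨ ∑∑-distrib-+ (upper A) (upper B) ⟨
  ∑∑ (λ i j → upper A i j + upper B i j)
    ≡⟨ sum-cong-≗ (λ i → sum-cong-≗ (upper-additive i)) ⟩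
  ∑∑ (λ i j → upper C i j + upper D i j)
    ≡⟨ ∑∑-distrib-+ (upper C) (upper D) ⟩
  ∑∑ (upper C) + ∑∑ (upper D)        ≡⟨ cong₂ _+_ (size≡∑∑upper C) (size≡∑∑upper D) ⟨
  size C + size D                    ∎
  where
  open ≡-Reasoning
  ∑∑ : (Fin n → Fin n → ℕ) → ℕ
  ∑∑ f = ∑[ i < n ] ∑[ j < n ] f i j
  ∑∑-distrib-+ : ∀ f g → ∑∑ (λ i j → f i j + g i j) ≡ ∑∑ f + ∑∑ g
  ∑∑-distrib-+ f g = trans (sum-cong-≗ (λ i → ∑-distrib-+ (f i) (g i)))
                           (∑-distrib-+ (λ i → ∑[ j < n ] f i j) (λ i → ∑[ j < n ] g i j))
  upper-additive : ∀ i j → upper A i j + upper B i j ≡ upper C i j + upper D i j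
  upper-additive i j with toℕ i <ᵇ toℕ j
  ... | true  = pointwise i j
  ... | false = refl

size-empty : ∀ {n} → size {n} (λ _ _ → false) ≡ 0
size-empty {n} =
  trans (size≡∑∑upper {n} (λ _ _ → false))
        (∑-zero {n} λ i → ∑-zero {n} λ j → cong χ (∧-zeroʳ _))

size-mono-degreeSum : ∀ {n} {A B : EdgeSet n} → SimpleEdgeSet A → SimpleEdgeSet B →
                      degreeSum A ≤ degreeSum B → size A ≤ size B
size-mono-degreeSum simpleA simpleB A≤B =
  *-cancelˡ-≤ 2 (subst₂ _≤_ (handshake simpleA) (handshake simpleB) A≤B)

covers⇒size>0 : ∀ {n} {A : EdgeSet n} → SimpleEdgeSet A → ∀ {i} → Covers A i → 0 < size A
covers⇒size>0 {A = A} simple {i} covered = *-cancelˡ-< 2 0 (size A) (begin-strict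
  0              <⟨ covers⇒degree>0 {A = A} covered ⟩
  degree A i     ≤⟨ term≤∑ (degree A) i ⟩
  degreeSum A    ≡⟨ handshake simple ⟩
  2 * size A     ∎)
  where open ≤-Reasoning

matching-loopless : ∀ {n} {G : Graph n} {A : EdgeSet n} → IsMatching G A → Loopless A
matching-loopless {G = G} {A} matching i with A i i in Aii
... | false = refl
... | true  with () ← trans (sym (IsMatching.sub matching i i Aii)) (irrefl G i)

matching-irreflexive : ∀ {n} {G : Graph n} {A : EdgeSet n} → IsMatching G A →
                       ∀ {i k} → A i k ≡ true → i ≢ k
matching-irreflexive matching {i} Aik refl with () ← trans (sym Aik) (matching-loopless matching i)

∩-matching-simple : ∀ {n} {G : Graph n} {P X : EdgeSet n} → SymmetricEdges P → IsMatching G X →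
                    SimpleEdgeSet (P ∩ X)
∩-matching-simple {P = P} symP X-matching = record
  { symmetric = λ i j → cong₂ _∧_ (symP i j) (IsMatching.symm X-matching i j)
  ; loopless  = λ i → trans (cong (P i i ∧_) (matching-loopless X-matching i)) (∧-zeroʳ (P i i))
  }

∩-atMostOneʳ : ∀ {n} {A B : EdgeSet n} → AtMostOneNeighbour B → AtMostOneNeighbour (A ∩ B)
∩-atMostOneʳ {A = A} unique i j k ABij ABik =
  unique i j k (proj₂ (∧-true {A i j} ABij)) (proj₂ (∧-true {A i k} ABik))

-- Switching a matching along an edge set

record IsSwitchingSet {n} (M H P : EdgeSet n) : Set where
  field
    symmetric : SymmetricEdges P
    ⊆-symDiff : ∀ i j → P i j ≡ true →
                M i j ≡ true × H i j ≡ false ⊎ H i j ≡ true × M i j ≡ false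
    M-closed  : ∀ i j k → P i j ≡ true → H i j ≡ true → M i k ≡ true → P i k ≡ true

switch : ∀ {n} → EdgeSet n → EdgeSet n → EdgeSet n → EdgeSet n
switch M H P i j = if P i j then H i j else M i j

module _ {n} {G : Graph n} {M H P : EdgeSet n}
         (Mm : IsMatching G M) (Hm : IsMatching G H) (switching : IsSwitchingSet M H P) where
  open IsSwitchingSet switching

  switch-isMatching : IsMatching G (switch M H P)
  switch-isMatching = record { symm = symm ; sub = sub ; unique = unique }
    where
    symm : SymmetricEdges (switch M H P)
    symm i j rewrite symmetric i j | IsMatching.symm Mm i j | IsMatching.symm Hm i j = refl

    sub : ∀ i j → switch M H P i j ≡ true → adj G i j ≡ true
    sub i j with P i j
    ... | true  = IsMatching.sub Hm i j
    ... | false = IsMatching.sub Mm i j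

    unique : AtMostOneNeighbour (switch M H P)
    unique i j k Sij Sik with P i j in Pij | P i k in Pik
    ... | true  | true  = IsMatching.unique Hm i j k Sij Sik
    ... | false | false = IsMatching.unique Mm i j k Sij Sik
    ... | true  | false with () ← trans (sym (M-closed i j k Pij Sij Sik)) Pik
    ... | false | true  with () ← trans (sym (M-closed i k j Pik Sik Sij)) Pij

  size-switch : size (switch M H P) + size (P ∩ M) ≡ size M + size (P ∩ H)
  size-switch = size-additive pointwise
    where
    pointwise : ∀ i j → χ (switch M H P i j) + χ (P i j ∧ M i j) ≡ χ (M i j) + χ (P i j ∧ H i j)
    pointwise i j with P i j
    ... | true  = +-comm (χ (H i j)) (χ (M i j))
    ... | false = refl

  size-switch-∩ : size (switch M H P ∩ H) ≡ size (M ∩ H) + size (P ∩ H)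
  size-switch-∩ = begin
    size (switch M H P ∩ H)                    ≡⟨ +-identityʳ _ ⟨
    size (switch M H P ∩ H) + 0                ≡⟨ cong (size (switch M H P ∩ H) +_) (size-empty {n}) ⟨
    size (switch M H P ∩ H) + size {n} (λ _ _ → false)
                                               ≡⟨ size-additive pointwise ⟩
    size (M ∩ H) + size (P ∩ H)                ∎
    where
    open ≡-Reasoning
    pointwise : ∀ i j → χ (switch M H P i j ∧ H i j) + χ false
                      ≡ χ (M i j ∧ H i j) + χ (P i j ∧ H i j)
    pointwise i j with P i j in Pij
    ... | false = refl
    ... | true  with ⊆-symDiff i j Pij
    ...   | inj₁ (Mij , Hij) rewrite Mij | Hij = refl
    ...   | inj₂ (Hij , Mij) rewrite Mij | Hij = refl

no-improving-switch : ∀ {n} {G : Graph n} {H H' M P : EdgeSet n} → StandingSetting G H H' M →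
  IsSwitchingSet M H P → degreeSum (P ∩ M) ≤ degreeSum (P ∩ H) → ∀ {t} → ¬ Covers (P ∩ H) t
no-improving-switch {n} {G} {H} {H'} {M} {P} (inM2 , (Mm , M-maximum) , M∩H-maximal , _)
                    switching P∩M≤P∩H covered =
  <⇒≱ M∩H<M'∩H (M∩H-maximal H H' M' inM2 M'-maximum)
  where
  Hm : IsMatching G H
  Hm = proj₁ (proj₁ inM2)

  M' : EdgeSet n
  M' = switch M H P

  P∩M-simple : SimpleEdgeSet (P ∩ M)
  P∩M-simple = ∩-matching-simple (IsSwitchingSet.symmetric switching) Mm

  P∩H-simple : SimpleEdgeSet (P ∩ H)
  P∩H-simple = ∩-matching-simple (IsSwitchingSet.symmetric switching) Hm

  size-P∩M≤P∩H : size (P ∩ M) ≤ size (P ∩ H)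
  size-P∩M≤P∩H = size-mono-degreeSum P∩M-simple P∩H-simple P∩M≤P∩H

  M≤M' : size M ≤ size M'
  M≤M' = +-cancelʳ-≤ (size (P ∩ M)) _ _ (begin
    size M + size (P ∩ M)   ≤⟨ +-monoʳ-≤ (size M) size-P∩M≤P∩H ⟩
    size M + size (P ∩ H)   ≡⟨ size-switch Mm Hm switching ⟨
    size M' + size (P ∩ M)  ∎)
    where open ≤-Reasoning

  M'-maximum : IsMaximumMatching G M'
  M'-maximum = switch-isMatching Mm Hm switching , λ N Nm → ≤-trans (M-maximum N Nm) M≤M'

  M∩H<M'∩H : size (M ∩ H) < size (M' ∩ H)
  M∩H<M'∩H = begin-strict
    size (M ∩ H)                ≡⟨ +-identityʳ _ ⟨
    size (M ∩ H) + 0            <⟨ +-monoʳ-< (size (M ∩ H)) (covers⇒size>0 P∩H-simple covered) ⟩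
    size (M ∩ H) + size (P ∩ H) ≡⟨ size-switch-∩ Mm Hm switching ⟨
    size (M' ∩ H)               ∎
    where open ≤-Reasoning

WalkEdge : ∀ {n} → List (Fin n) → Fin n → Fin n → Set
WalkEdge []           i j = ⊥
WalkEdge (x ∷ [])     i j = ⊥
WalkEdge (x ∷ y ∷ vs) i j = i ≡ x × j ≡ y ⊎ i ≡ y × j ≡ x ⊎ WalkEdge (y ∷ vs) i j

walkEdge? : ∀ {n} (vs : List (Fin n)) i j → Dec (WalkEdge vs i j)
walkEdge? []           i j = no λ ()
walkEdge? (x ∷ [])     i j = no λ ()
walkEdge? (x ∷ y ∷ vs) i j =
  (i ≟ x ×-dec j ≟ y) ⊎-dec (i ≟ y ×-dec j ≟ x) ⊎-dec walkEdge? (y ∷ vs) i j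

walkEdges : ∀ {n} → List (Fin n) → EdgeSet n
walkEdges vs i j = does (walkEdge? vs i j)

WalkCovers : ∀ {n} → EdgeSet n → List (Fin n) → Fin n → Set
WalkCovers A vs i = ∃[ j ] WalkEdge vs i j × A i j ≡ true

Alternating : ∀ {n} → EdgeSet n → EdgeSet n → List (Fin n) → Set
Alternating A B vs = AltFrom A B vs ⊎ AltFrom B A vs

walkEdge-sym : ∀ {n} (vs : List (Fin n)) {i j} → WalkEdge vs i j → WalkEdge vs j i
walkEdge-sym (x ∷ y ∷ vs) (inj₁ (i≡x , j≡y))        = inj₂ (inj₁ (j≡y , i≡x))
walkEdge-sym (x ∷ y ∷ vs) (inj₂ (inj₁ (i≡y , j≡x))) = inj₁ (j≡x , i≡y)
walkEdge-sym (x ∷ y ∷ vs) (inj₂ (inj₂ ij))          = inj₂ (inj₂ (walkEdge-sym (y ∷ vs) ij))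

module _ {n} (vs : List (Fin n)) where

  walkEdges-symmetric : SymmetricEdges (walkEdges vs)
  walkEdges-symmetric i j =
    does-⇔ (mk⇔ (walkEdge-sym vs) (walkEdge-sym vs)) (walkEdge? vs i j) (walkEdge? vs j i)

  walkCovers⇒covers : ∀ {A : EdgeSet n} {i} → WalkCovers A vs i → Covers (walkEdges vs ∩ A) i
  walkCovers⇒covers {i = i} (j , ij , Aij) = j , ∧-intro (dec-true (walkEdge? vs i j) ij) Aij

  walkEdges⇒walkEdge : ∀ {i j} → walkEdges vs i j ≡ true → WalkEdge vs i j
  walkEdges⇒walkEdge {i} {j} with walkEdge? vs i j
  ... | yes ij = λ _ → ij
  ... | no  _  = λ ()

  covers⇒walkCovers : ∀ {A : EdgeSet n} {i} → Covers (walkEdges vs ∩ A) i → WalkCovers A vs i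
  covers⇒walkCovers {A} {i} (j , PAij) with ∧-true {walkEdges vs i j} PAij
  ... | Pij , Aij = j , walkEdges⇒walkEdge Pij , Aij

walkEdge-∈ : ∀ {n} (vs : List (Fin n)) {i j} → WalkEdge vs i j → i ∈ vs
walkEdge-∈ (x ∷ y ∷ vs) (inj₁ (i≡x , _))        = here i≡x
walkEdge-∈ (x ∷ y ∷ vs) (inj₂ (inj₁ (i≡y , _))) = there (here i≡y)
walkEdge-∈ (x ∷ y ∷ vs) (inj₂ (inj₂ ij))        = there (walkEdge-∈ (y ∷ vs) ij)

∈⇒walkEdge : ∀ {n} (vs : List (Fin n)) {i} → i ∈ vs → 1 ≤ edges vs → ∃[ j ] WalkEdge vs i j
∈⇒walkEdge (x ∷ y ∷ vs)     (here refl)         _ = y , inj₁ (refl , refl)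
∈⇒walkEdge (x ∷ y ∷ [])     (there (here refl)) _ = x , inj₂ (inj₁ (refl , refl))
∈⇒walkEdge (x ∷ y ∷ z ∷ vs) (there i∈)          _ with ∈⇒walkEdge (y ∷ z ∷ vs) i∈ (s≤s z≤n)
... | j , ij = j , inj₂ (inj₂ ij)

walkCovers-∷ : ∀ {n} {A : EdgeSet n} {x y vs i} →
               WalkCovers A (y ∷ vs) i → WalkCovers A (x ∷ y ∷ vs) i
walkCovers-∷ (j , ij , Aij) = j , inj₂ (inj₂ ij) , Aij

head-covered : ∀ {n} {A B : EdgeSet n} {x y vs} →
               AltFrom A B (x ∷ y ∷ vs) → WalkCovers A (x ∷ y ∷ vs) x
head-covered (Axy , _) = _ , inj₁ (refl , refl) , Axy

tail-alternating : ∀ {n} {A B : EdgeSet n} {x y vs} →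
                   Alternating A B (x ∷ y ∷ vs) → Alternating A B (y ∷ vs)
tail-alternating (inj₁ (_ , _ , alt)) = inj₂ alt
tail-alternating (inj₂ (_ , _ , alt)) = inj₁ alt

altFrom-colour : ∀ {n} {A B : EdgeSet n} → SymmetricEdges A → SymmetricEdges B →
  ∀ vs → AltFrom A B vs → ∀ {i j} → WalkEdge vs i j →
  A i j ≡ true × B i j ≡ false ⊎ B i j ≡ true × A i j ≡ false
altFrom-colour symA symB (x ∷ y ∷ vs) (Axy , Bxy , _) (inj₁ (refl , refl))        = inj₁ (Axy , Bxy)
altFrom-colour symA symB (x ∷ y ∷ vs) (Axy , Bxy , _) (inj₂ (inj₁ (refl , refl))) =
  inj₁ (trans (symA y x) Axy , trans (symB y x) Bxy)
altFrom-colour symA symB (x ∷ y ∷ vs) (_ , _ , alt) (inj₂ (inj₂ ij)) =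
  swap (altFrom-colour symB symA (y ∷ vs) alt ij)

alternating-colour : ∀ {n} {A B : EdgeSet n} → SymmetricEdges A → SymmetricEdges B →
  ∀ vs → Alternating A B vs → ∀ {i j} → WalkEdge vs i j →
  A i j ≡ true × B i j ≡ false ⊎ B i j ≡ true × A i j ≡ false
alternating-colour symA symB vs (inj₁ alt) ij = altFrom-colour symA symB vs alt ij
alternating-colour symA symB vs (inj₂ alt) ij = swap (altFrom-colour symB symA vs alt ij)

alternating-interior : ∀ {n} {A B : EdgeSet n} → SymmetricEdges A → SymmetricEdges B →
  ∀ vs → Alternating A B vs → ∀ {i} → WalkCovers A vs i →
  WalkCovers B vs i ⊎ head vs ≡ just i ⊎ last vs ≡ just i
alternating-interior _ _ (x ∷ y ∷ vs) _ (_ , inj₁ (refl , refl) , _) = inj₂ (inj₁ refl)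
alternating-interior _ _ (x ∷ y ∷ []) _ (_ , inj₂ (inj₁ (refl , refl)) , _) = inj₂ (inj₂ refl)
alternating-interior _ _ (x ∷ y ∷ z ∷ vs) (inj₁ (_ , _ , Byz , _)) (_ , inj₂ (inj₁ (refl , refl)) , _) =
  inj₁ (z , inj₂ (inj₂ (inj₁ (refl , refl))) , Byz)
alternating-interior symA _ (x ∷ y ∷ z ∷ vs) (inj₂ (_ , Axy≡false , _))
                     (_ , inj₂ (inj₁ (refl , refl)) , Ayx)
  with () ← trans (sym Axy≡false) (trans (symA x y) Ayx)
alternating-interior {A = A} {B} symA symB (x ∷ y ∷ vs) alt (j , inj₂ (inj₂ ij) , Aij)
  with alternating-interior symA symB (y ∷ vs) (tail-alternating alt) (j , ij , Aij)
... | inj₁ covered       = inj₁ (walkCovers-∷ {A = B} covered)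
... | inj₂ (inj₂ last≡i) = inj₂ (inj₂ last≡i)
... | inj₂ (inj₁ refl)   = inj₁ (second-vertex-covered vs alt ij)
  where
  second-vertex-covered : ∀ vs → Alternating A B (x ∷ y ∷ vs) → WalkEdge (y ∷ vs) y j →
                          WalkCovers B (x ∷ y ∷ vs) y
  second-vertex-covered vs       (inj₂ (Bxy , _)) _ = x , inj₂ (inj₁ (refl , refl)) , trans (symB y x) Bxy
  second-vertex-covered (z ∷ vs) (inj₁ (_ , _ , Byz , _)) _ = z , inj₂ (inj₂ (inj₁ (refl , refl))) , Byz

last-covered : ∀ {n} {A B : EdgeSet n} → SymmetricEdges A → SymmetricEdges B →
  ∀ vs → AltFrom A B vs → 1 ≤ edges vs → ∀ {t} → last vs ≡ just t →
  (Even (edges vs) → WalkCovers B vs t) × (Odd (edges vs) → WalkCovers A vs t)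
last-covered symA _ (x ∷ y ∷ []) (Axy , _) _ refl =
  (λ ()) , λ _ → x , inj₂ (inj₁ (refl , refl)) , trans (symA y x) Axy
last-covered {A = A} {B} symA symB (x ∷ y ∷ z ∷ vs) (_ , _ , alt) _ last≡t
  with even⇒A , odd⇒B ← last-covered symB symA (y ∷ z ∷ vs) alt (s≤s z≤n) last≡t =
  (λ odd → walkCovers-∷ {A = B} (odd⇒B odd)) , (λ even → walkCovers-∷ {A = A} (even⇒A even))

altFrom-∷ʳ : ∀ {n} {A B : EdgeSet n} vs {i k} → AltFrom A B vs → last vs ≡ just i →
  (Even (edges vs) → A i k ≡ true × B i k ≡ false) →
  (Odd (edges vs) → B i k ≡ true × A i k ≡ false) →
  AltFrom A B (vs ++ [ k ])
altFrom-∷ʳ (x ∷ [])     _                 refl even _   = proj₁ (even tt) , proj₂ (even tt) , tt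
altFrom-∷ʳ (x ∷ y ∷ vs) (Axy , Bxy , alt) last≡i even odd =
  Axy , Bxy , altFrom-∷ʳ (y ∷ vs) alt last≡i odd even

module _ {n} {A B : EdgeSet n} (symA : SymmetricEdges A) (symB : SymmetricEdges B) where

  alternating-∷ : ∀ {x vs k} → Alternating A B (x ∷ vs) → ¬ WalkCovers A (x ∷ vs) x →
                  A k x ≡ true → B k x ≡ false → Alternating A B (k ∷ x ∷ vs)
  alternating-∷               (inj₂ alt)         _         Akx Bkx = inj₁ (Akx , Bkx , alt)
  alternating-∷ {vs = []}     (inj₁ _)           _         Akx Bkx = inj₁ (Akx , Bkx , tt)
  alternating-∷ {vs = y ∷ vs} (inj₁ (Axy , _)) uncovered _   _   =
    ⊥-elim (uncovered (y , inj₁ (refl , refl) , Axy))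

  alternating-∷ʳ : ∀ vs {i k} → Alternating A B vs → 1 ≤ edges vs → last vs ≡ just i →
                   ¬ WalkCovers A vs i → A i k ≡ true → B i k ≡ false → Alternating A B (vs ++ [ k ])
  alternating-∷ʳ vs (inj₁ alt) nonempty last≡i uncovered Aik Bik =
    inj₁ (altFrom-∷ʳ vs alt last≡i (λ _ → Aik , Bik)
           (λ odd → ⊥-elim (uncovered (proj₂ (last-covered symA symB vs alt nonempty last≡i) odd))))
  alternating-∷ʳ vs (inj₂ alt) nonempty last≡i uncovered Aik Bik =
    inj₂ (altFrom-∷ʳ vs alt last≡i
           (λ even → ⊥-elim (uncovered (proj₁ (last-covered symB symA vs alt nonempty last≡i) even)))
           (λ _ → Aik , Bik))

  alternating-cycle : ∀ x vs {t} → Unique (x ∷ vs) → Alternating A B (x ∷ vs) → 1 ≤ edges (x ∷ vs) →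
    last (x ∷ vs) ≡ just t → ¬ WalkCovers A (x ∷ vs) x → ¬ WalkCovers A (x ∷ vs) t →
    A t x ≡ true → B t x ≡ false → AltCycle A B (x ∷ vs)
  alternating-cycle x (y ∷ vs) _ (inj₁ (Axy , _)) _ _ x-uncovered _ _ _ =
    ⊥-elim (x-uncovered (y , inj₁ (refl , refl) , Axy))
  alternating-cycle x vs {t} unique (inj₂ alt) nonempty last≡t _ t-uncovered Atx Btx
    with even⊎odd (length vs)
  ... | inj₁ even =
    ⊥-elim (t-uncovered (proj₁ (last-covered symB symA (x ∷ vs) alt nonempty last≡t) even))
  ... | inj₂ odd  =
    unique , 3≤length vs nonempty alt last≡t , even⇒2∣ (suc (length vs)) odd ,
    inj₂ (altFrom-∷ʳ (x ∷ vs) alt last≡t (λ even → ⊥-elim (even⇒¬odd (length vs) even odd))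
                                         (λ _ → Atx , Btx))
    where
    3≤length : ∀ vs → 1 ≤ edges (x ∷ vs) → AltFrom B A (x ∷ vs) → last (x ∷ vs) ≡ just t →
               3 ≤ length (x ∷ vs)
    3≤length (y ∷ [])     _ (_ , Axy≡false , _) refl
      with () ← trans (sym Axy≡false) (trans (symA x y) Atx)
    3≤length (y ∷ z ∷ vs) _ _ _ = s≤s (s≤s (s≤s z≤n))

  endpoint-monochrome : ∀ vs {i} → Alternating A B vs →
                        (∀ {j j′} → WalkEdge vs i j → WalkEdge vs i j′ → j ≡ j′) →
                        WalkCovers A vs i → ¬ WalkCovers B vs i
  endpoint-monochrome vs alt one-edge (j , ij , Aij) (j′ , ij′ , Bij′) with refl ← one-edge ij ij′
    with alternating-colour symA symB vs alt ij
  ... | inj₁ (_ , Bij≡false) with () ← trans (sym Bij′) Bij≡false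
  ... | inj₂ (_ , Aij≡false) with () ← trans (sym Aij) Aij≡false

last-∈ : ∀ {n} (vs : List (Fin n)) {t} → last vs ≡ just t → t ∈ vs
last-∈ (x ∷ [])     refl   = here refl
last-∈ (x ∷ y ∷ vs) last≡t = there (last-∈ (y ∷ vs) last≡t)

last-∷ʳ : ∀ {n} (vs : List (Fin n)) x → last (vs ++ [ x ]) ≡ just x
last-∷ʳ []           x = refl
last-∷ʳ (v ∷ [])     x = refl
last-∷ʳ (v ∷ w ∷ vs) x = last-∷ʳ (w ∷ vs) x

last-exists : ∀ {n} (x : Fin n) vs → ∃[ t ] last (x ∷ vs) ≡ just t
last-exists x []       = x , refl
last-exists x (y ∷ vs) = last-exists y vs

head≢last : ∀ {n} {x y : Fin n} {vs t} → Unique (x ∷ y ∷ vs) → last (x ∷ y ∷ vs) ≡ just t → x ≢ t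
head≢last {y = y} {vs} (x∉ ∷ _) last≡t refl = All¬⇒¬Any x∉ (last-∈ (y ∷ vs) last≡t)

head-walkEdge : ∀ {n} {x y : Fin n} {vs j} → Unique (x ∷ y ∷ vs) → WalkEdge (x ∷ y ∷ vs) x j → j ≡ y
head-walkEdge _                     (inj₁ (_ , j≡y))        = j≡y
head-walkEdge ((x≢y ∷ _) ∷ _)       (inj₂ (inj₁ (x≡y , _))) = ⊥-elim (x≢y x≡y)
head-walkEdge {y = y} {vs} (x∉ ∷ _) (inj₂ (inj₂ xj))        =
  ⊥-elim (All¬⇒¬Any x∉ (walkEdge-∈ (y ∷ vs) xj))

last-walkEdge-unique : ∀ {n} (vs : List (Fin n)) {t j j′} → Unique vs → last vs ≡ just t →
                       WalkEdge vs t j → WalkEdge vs t j′ → j ≡ j′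
last-walkEdge-unique (x ∷ y ∷ []) ((x≢y ∷ []) ∷ _) refl tj tj′ = trans (partner tj) (sym (partner tj′))
  where
  partner : ∀ {j} → WalkEdge (x ∷ y ∷ []) y j → j ≡ x
  partner (inj₁ (y≡x , _))        = ⊥-elim (x≢y (sym y≡x))
  partner (inj₂ (inj₁ (_ , j≡x))) = j≡x
last-walkEdge-unique (x ∷ y ∷ z ∷ vs) {t} (x∉ ∷ unique@(y∉ ∷ _)) last≡t tj tj′ =
  last-walkEdge-unique (y ∷ z ∷ vs) unique last≡t (in-tail tj) (in-tail tj′)
  where
  in-tail : ∀ {j} → WalkEdge (x ∷ y ∷ z ∷ vs) t j → WalkEdge (y ∷ z ∷ vs) t j
  in-tail (inj₁ (refl , _))        = ⊥-elim (All¬⇒¬Any x∉ (last-∈ (y ∷ z ∷ vs) last≡t))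
  in-tail (inj₂ (inj₁ (refl , _))) = ⊥-elim (All¬⇒¬Any y∉ (last-∈ (z ∷ vs) last≡t))
  in-tail (inj₂ (inj₂ tj))         = tj

module _ {n} {X : EdgeSet n} (unique : AtMostOneNeighbour X) (vs : List (Fin n)) {i k : Fin n} where

  walk-partner : WalkCovers X vs i → X i k ≡ true → WalkEdge vs i k
  walk-partner (j , ij , Xij) Xik with refl ← unique _ _ _ Xij Xik = ij

  off-walk⇒uncovered : X i k ≡ true → ¬ WalkEdge vs i k → ¬ WalkCovers X vs i
  off-walk⇒uncovered Xik ¬ik covered = ¬ik (walk-partner covered Xik)

  off-walk⇒absent : WalkCovers X vs i → ¬ WalkEdge vs i k → X i k ≡ false
  off-walk⇒absent covered ¬ik with X i k in Xik
  ... | true  = ⊥-elim (¬ik (walk-partner covered Xik))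
  ... | false = refl

module _ {n} {G : Graph n} {M H : EdgeSet n} (Mm : IsMatching G M) (Hm : IsMatching G H) where

  walk-switching : ∀ vs → Alternating M H vs →
    (∀ {i k} → WalkCovers H vs i → M i k ≡ true → WalkEdge vs i k) → IsSwitchingSet M H (walkEdges vs)
  walk-switching vs alt M-closed = record
    { symmetric = walkEdges-symmetric vs
    ; ⊆-symDiff = λ i j Pij →
        alternating-colour (IsMatching.symm Mm) (IsMatching.symm Hm) vs alt (walkEdges⇒walkEdge vs Pij)
    ; M-closed  = λ i j k Pij Hij Mik →
        dec-true (walkEdge? vs i k) (M-closed (j , walkEdges⇒walkEdge vs Pij , Hij) Mik)
    }

  walk-degreeSum-mono : ∀ vs → (∀ i → WalkCovers M vs i → WalkCovers H vs i) →
                        degreeSum (walkEdges vs ∩ M) ≤ degreeSum (walkEdges vs ∩ H)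
  walk-degreeSum-mono vs M⇒H =
    degreeSum-mono {A = walkEdges vs ∩ M} {B = walkEdges vs ∩ H} (∩-atMostOneʳ (IsMatching.unique Mm))
      (λ i covered → walkCovers⇒covers vs {H} (M⇒H i (covers⇒walkCovers vs {M} covered)))

  walk-degreeSum-exchange : ∀ vs {h t} → h ≢ t →
    (∀ i → i ≢ h → WalkCovers M vs i → WalkCovers H vs i) → ¬ WalkCovers M vs t → WalkCovers H vs t →
    degreeSum (walkEdges vs ∩ M) ≤ degreeSum (walkEdges vs ∩ H)
  walk-degreeSum-exchange vs h≢t M⇒H t-uncovered t-covered =
    degreeSum-exchange {A = walkEdges vs ∩ M} {B = walkEdges vs ∩ H} (∩-atMostOneʳ (IsMatching.unique Mm))
      h≢t (λ i i≢h covered → walkCovers⇒covers vs {H} (M⇒H i i≢h (covers⇒walkCovers vs {M} covered)))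
      (t-uncovered ∘ covers⇒walkCovers vs {M}) (walkCovers⇒covers vs {H} t-covered)

-- Cycles and maximal paths in the standing setting

module _ {n} {G : Graph n} {H H' M : EdgeSet n} (standing : StandingSetting G H H' M) where

  private
    Mm : IsMatching G M
    Mm = proj₁ (proj₁ (proj₂ standing))

    Hm : IsMatching G H
    Hm = proj₁ (proj₁ (proj₁ standing))

    symM : SymmetricEdges M
    symM = IsMatching.symm Mm

    symH : SymmetricEdges H
    symH = IsMatching.symm Hm

    no-improving-walk : ∀ vs → Alternating M H vs →
      (∀ {i k} → WalkCovers H vs i → M i k ≡ true → WalkEdge vs i k) →
      degreeSum (walkEdges vs ∩ M) ≤ degreeSum (walkEdges vs ∩ H) → ∀ {t} → ¬ WalkCovers H vs t
    no-improving-walk vs alt M-closed M≤H covered =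
      no-improving-switch standing (walk-switching Mm Hm vs alt M-closed) M≤H (walkCovers⇒covers vs {H} covered)

  no-alternating-cycle : ∀ vs → ¬ AltCycle M H vs
  no-alternating-cycle (w ∷ [])     (_ , s≤s () , _)
  no-alternating-cycle (w ∷ y ∷ vs) (_ , _ , 2∣length , alt) =
    no-improving-walk cs alt M-closed (walk-degreeSum-mono Mm Hm cs (cycle-covers symM symH alt))
                      (w-covered symM symH alt)
    where
    cs : List (Fin n)
    cs = w ∷ y ∷ vs ++ [ w ]

    even : Even (edges cs)
    even = subst Even (cong suc (trans (+-comm 1 (length vs)) (sym (length-++ vs))))
                 (2∣⇒even (length (w ∷ y ∷ vs)) 2∣length)

    last≡w : last cs ≡ just w
    last≡w = last-∷ʳ (w ∷ y ∷ vs) w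

    w-covered : ∀ {A B : EdgeSet n} → SymmetricEdges A → SymmetricEdges B →
                Alternating A B cs → WalkCovers B cs w
    w-covered symA symB (inj₁ alt) = proj₁ (last-covered symA symB cs alt (s≤s z≤n) last≡w) even
    w-covered symA symB (inj₂ alt) = head-covered alt

    cycle-covers : ∀ {A B : EdgeSet n} → SymmetricEdges A → SymmetricEdges B →
                   Alternating A B cs → ∀ i → WalkCovers A cs i → WalkCovers B cs i
    cycle-covers symA symB alt i covered with alternating-interior symA symB cs alt covered
    ... | inj₁ covered′      = covered′
    ... | inj₂ (inj₁ refl)   = w-covered symA symB alt
    ... | inj₂ (inj₂ last≡i) with refl ← just-injective (trans (sym last≡w) last≡i) =
      w-covered symA symB alt

    M-closed : ∀ {i k} → WalkCovers H cs i → M i k ≡ true → WalkEdge cs i k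
    M-closed covered = walk-partner (IsMatching.unique Mm) cs (cycle-covers symH symM (swap alt) _ covered)

  module _ {x y r} (maximal : MaxAltPath M H (x ∷ y ∷ r)) where

    private
      vs : List (Fin n)
      vs = x ∷ y ∷ r

      unique : Unique vs
      unique = proj₁ (proj₁ maximal)

      alt : Alternating M H vs
      alt = proj₂ (proj₂ (proj₁ maximal))

      only-trivial-extension : ∀ xs ys → AltPath M H (xs ++ vs ++ ys) → xs ≡ [] × ys ≡ []
      only-trivial-extension = proj₂ maximal

      H-only⇒endpoint : ∀ {i} → WalkCovers H vs i → ¬ WalkCovers M vs i →
                        head vs ≡ just i ⊎ last vs ≡ just i
      H-only⇒endpoint H-covered M-uncovered with alternating-interior symH symM vs (swap alt) H-covered
      ... | inj₁ M-covered = ⊥-elim (M-uncovered M-covered)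
      ... | inj₂ endpoint  = endpoint

      no-extension-at-head : ∀ {i k} → k ∉ vs → head vs ≡ just i → ¬ WalkCovers M vs i →
                             M k i ≡ true → H k i ≡ false → ⊥
      no-extension-at-head {k = k} k∉ refl uncovered Mki Hki
        with () ← proj₁ (only-trivial-extension [ k ] []
                    (subst (AltPath M H) (cong (k ∷_) (sym (++-identityʳ vs)))
                      (¬Any⇒All¬ vs k∉ ∷ unique , s≤s z≤n , alternating-∷ symM symH alt uncovered Mki Hki)))

      no-extension-at-last : ∀ {i k} → k ∉ vs → last vs ≡ just i → ¬ WalkCovers M vs i →
                             M i k ≡ true → H i k ≡ false → ⊥
      no-extension-at-last {k = k} k∉ last≡i uncovered Mik Hik
        with () ← proj₂ (only-trivial-extension [] [ k ]
                    (++⁺ unique ([] ∷ []) (λ { (k∈ , here refl) → k∉ k∈ }) , s≤s z≤n ,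
                     alternating-∷ʳ symM symH vs alt (s≤s z≤n) last≡i uncovered Mik Hik))

      no-M-edge-between-ends : ∀ {i k} → i ≢ k →
        head vs ≡ just i ⊎ last vs ≡ just i → head vs ≡ just k ⊎ last vs ≡ just k →
        ¬ WalkCovers M vs i → ¬ WalkCovers M vs k → M i k ≡ true → H i k ≡ false → ⊥
      no-M-edge-between-ends i≢k (inj₁ refl)    (inj₁ refl)    _ _ _ _ = i≢k refl
      no-M-edge-between-ends i≢k (inj₂ last≡i) (inj₂ last≡k) _ _ _ _ =
        i≢k (just-injective (trans (sym last≡i) last≡k))
      no-M-edge-between-ends {i} {k} _ (inj₁ refl) (inj₂ last≡k) i-uncovered k-uncovered Mik Hik =
        no-alternating-cycle vs (alternating-cycle symM symH x (y ∷ r) unique alt (s≤s z≤n) last≡k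
                                   i-uncovered k-uncovered (trans (symM k i) Mik) (trans (symH k i) Hik))
      no-M-edge-between-ends _ (inj₂ last≡i) (inj₁ refl) i-uncovered k-uncovered Mik Hik =
        no-alternating-cycle vs (alternating-cycle symM symH x (y ∷ r) unique alt (s≤s z≤n) last≡i
                                   k-uncovered i-uncovered Mik Hik)

      -- An M-edge ik leaving the path at a vertex i of one of its H-edges makes i an endpoint
      -- without an M-edge on the path.  If k is off the path, ik extends it; if k is on it, k is
      -- the other such endpoint and ik closes an alternating cycle.
      M-closed : ∀ {i k} → WalkCovers H vs i → M i k ≡ true → WalkEdge vs i k
      M-closed {i} {k} i-H-covered Mik = decidable-stable (walkEdge? vs i k) λ ¬ik →
        [ k-on-path-impossible ¬ik , k-off-path-impossible ¬ik ]′ (toSum (any? (k ≟_) vs))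
        where
        module _ (¬ik : ¬ WalkEdge vs i k) where
          i-uncovered : ¬ WalkCovers M vs i
          i-uncovered = off-walk⇒uncovered (IsMatching.unique Mm) vs Mik ¬ik

          Hik : H i k ≡ false
          Hik = off-walk⇒absent (IsMatching.unique Hm) vs i-H-covered ¬ik

          i-endpoint : head vs ≡ just i ⊎ last vs ≡ just i
          i-endpoint = H-only⇒endpoint i-H-covered i-uncovered

          k-off-path-impossible : k ∉ vs → ⊥
          k-off-path-impossible k∉ = [
            (λ head≡i → no-extension-at-head k∉ head≡i i-uncovered
                                             (trans (symM k i) Mik) (trans (symH k i) Hik)) ,
            (λ last≡i → no-extension-at-last k∉ last≡i i-uncovered Mik Hik) ]′ i-endpoint

          k-on-path-impossible : k ∈ vs → ⊥
          k-on-path-impossible k∈ =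
            no-M-edge-between-ends (matching-irreflexive Mm Mik) i-endpoint k-endpoint
                                   i-uncovered k-uncovered Mik Hik
            where
            k-uncovered : ¬ WalkCovers M vs k
            k-uncovered = off-walk⇒uncovered (IsMatching.unique Mm) vs (trans (symM k i) Mik)
                                             (¬ik ∘ walkEdge-sym vs)

            k-H-covered : WalkCovers H vs k
            k-H-covered with l , kl ← ∈⇒walkEdge vs k∈ (s≤s z≤n)
                        with alternating-colour symM symH vs alt kl
            ... | inj₁ (Mkl , _) = ⊥-elim (k-uncovered (l , kl , Mkl))
            ... | inj₂ (Hkl , _) = l , kl , Hkl

            k-endpoint : head vs ≡ just k ⊎ last vs ≡ just k
            k-endpoint = H-only⇒endpoint k-H-covered k-uncovered

      no-improving-path : degreeSum (walkEdges vs ∩ M) ≤ degreeSum (walkEdges vs ∩ H) →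
                          ∀ {t} → ¬ WalkCovers H vs t
      no-improving-path = no-improving-walk vs alt M-closed

    even-path-from-M-impossible : AltFrom M H (x ∷ y ∷ r) → Even (edges (x ∷ y ∷ r)) → ⊥
    even-path-from-M-impossible altMH even with t , last≡t ← last-exists x (y ∷ r) =
      no-improving-path
        (walk-degreeSum-exchange Mm Hm vs (head≢last unique last≡t) M⇒H t-M-uncovered t-H-covered)
        t-H-covered
      where
      t-H-covered : WalkCovers H vs t
      t-H-covered = proj₁ (last-covered symM symH vs altMH (s≤s z≤n) last≡t) even

      t-M-uncovered : ¬ WalkCovers M vs t
      t-M-uncovered = endpoint-monochrome symH symM vs (swap alt)
                        (last-walkEdge-unique vs unique last≡t) t-H-covered

      M⇒H : ∀ i → i ≢ x → WalkCovers M vs i → WalkCovers H vs i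
      M⇒H i i≢x covered with alternating-interior symM symH vs alt covered
      ... | inj₁ H-covered     = H-covered
      ... | inj₂ (inj₁ refl)   = ⊥-elim (i≢x refl)
      ... | inj₂ (inj₂ last≡i) with refl ← just-injective (trans (sym last≡t) last≡i) = t-H-covered

    even-path-from-H-impossible : AltFrom H M (x ∷ y ∷ r) → Even (edges (x ∷ y ∷ r)) → ⊥
    even-path-from-H-impossible altHM even with t , last≡t ← last-exists x (y ∷ r) =
      no-improving-path
        (walk-degreeSum-exchange Mm Hm vs (head≢last unique last≡t ∘ sym) M⇒H x-M-uncovered x-H-covered)
        x-H-covered
      where
      x-H-covered : WalkCovers H vs x
      x-H-covered = head-covered altHM

      x-M-uncovered : ¬ WalkCovers M vs x
      x-M-uncovered = endpoint-monochrome symH symM vs (swap alt)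
                        (λ xj xj′ → trans (head-walkEdge unique xj) (sym (head-walkEdge unique xj′)))
                        x-H-covered

      M⇒H : ∀ i → i ≢ t → WalkCovers M vs i → WalkCovers H vs i
      M⇒H i i≢t covered with alternating-interior symM symH vs alt covered
      ... | inj₁ H-covered     = H-covered
      ... | inj₂ (inj₁ refl)   = x-H-covered
      ... | inj₂ (inj₂ last≡i) = ⊥-elim (i≢t (just-injective (trans (sym last≡i) last≡t)))

    odd-path-from-H-impossible : AltFrom H M (x ∷ y ∷ r) → Odd (edges (x ∷ y ∷ r)) → ⊥
    odd-path-from-H-impossible altHM odd with t , last≡t ← last-exists x (y ∷ r) =
      no-improving-path (walk-degreeSum-mono Mm Hm vs M⇒H) (head-covered altHM)
      where
      M⇒H : ∀ i → WalkCovers M vs i → WalkCovers H vs i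
      M⇒H i covered with alternating-interior symM symH vs alt covered
      ... | inj₁ H-covered     = H-covered
      ... | inj₂ (inj₁ refl)   = head-covered altHM
      ... | inj₂ (inj₂ last≡i) with refl ← just-injective (trans (sym last≡t) last≡i) =
        proj₂ (last-covered symH symM vs altHM (s≤s z≤n) last≡t) odd

  no-even-maximal-path : ∀ vs → MaxAltPath M H vs → ¬ 2 ∣ edges vs
  no-even-maximal-path (x ∷ y ∷ r) maximal 2∣edges with proj₂ (proj₂ (proj₁ maximal))
  ... | inj₁ altMH = even-path-from-M-impossible maximal altMH (2∣⇒even (edges (x ∷ y ∷ r)) 2∣edges)
  ... | inj₂ altHM = even-path-from-H-impossible maximal altHM (2∣⇒even (edges (x ∷ y ∷ r)) 2∣edges)

  no-odd-maximal-path-from-H : ∀ vs → MaxAltPath M H vs → ¬ 2 ∣ edges vs → ¬ AltFrom H M vs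
  no-odd-maximal-path-from-H (x ∷ y ∷ r) maximal 2∤edges altHM with even⊎odd (edges (x ∷ y ∷ r))
  ... | inj₁ even = 2∤edges (even⇒2∣ (edges (x ∷ y ∷ r)) even)
  ... | inj₂ odd  = odd-path-from-H-impossible maximal altHM odd

lemma1 : ∀ {n} (G : Graph n) (H H' M : EdgeSet n) → StandingSetting G H H' M →
    (∀ (vs : List (Fin n)) → ¬ AltCycle M H vs)
    × (∀ (vs : List (Fin n)) → MaxAltPath M H vs → ¬ (2 ∣ edges vs))
    × (∀ (vs : List (Fin n)) → MaxAltPath M H vs → ¬ (2 ∣ edges vs) → ¬ AltFrom H M vs)
lemma1 G H H' M standing =
  no-alternating-cycle standing , no-even-maximal-path standing , no-odd-maximal-path-from-H standing
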